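{- Let $s=(s_1,\dots,s_n)$ be a composition and let $\mathbf d$ be the netflow on the $s$-oruga graph $\mathcal O(s)$ given by the shifted in-degrees, i.e. $\mathbf d=(0,0,s_n,s_{n-1},\dots,s_2,-(s_2+\cdots+s_n))$ on the vertices $(v_{ -1},v_0,v_1,\dots,v_{n-1},v_n)$. The set of Stirling $s$-permutations is in bijection with the set of integer $\mathbf d$-flows of $\mathcal O(s)$.
   Context: A composition is a sequence of positive integers. A Stirling $s$-permutation is a rearrangement of the word $1^{s_1}2^{s_2}\cdots n^{s_n}$ avoiding the pattern $121$ (no $a<b$ with $a,b,a$ appearing in this order). Set $s_{n+1}:=2$. The $s$-oruga graph $\mathcal O(s)$ is the directed multigraph on $v_{ -1},v_0,\dots,v_n$ with: for each $i\in[n+1]$, $s_i-1$ source edges $v_{ -1}\to v_{n+1-i}$; for each $i\in[n]$, two parallel edges (bump and dip) $v_{n-i}\to v_{n+1-i}$. For a netflow $\mathbf a=(a_v)$ with $\sum_v a_v=0$, an $\mathbf a$-flow is $f:E\to\mathbb R_{\ge0}$ with $\sum_{e \text{ out of } v}f(e)-\sum_{e\text{ into } v}f(e)=a_v$ at every vertex $v$; it is integer if all values are integers. The shifted in-degree of $v$ is its in-degree minus one (with value $0$ at the source $v_{ -1}$, and the sink value chosen so the total is $0$). -}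

module Defs where

open import Data.Nat using (ℕ; zero; suc; _+_; _∸_; _≤_; _<_; _≡ᵇ_)
open import Data.Bool using (Bool; true; false; if_then_else_)
open import Data.Integer as ℤ using (ℤ; +_; -_)
open import Data.Fin as Fin using (Fin)
open import Data.Vec as Vec using (Vec)
open import Data.List using (List; []; _∷_; map; concatMap; replicate; upTo; zip; length; lookup; drop; _++_; [_])
open import Data.Nat.ListAction using (sum)
open import Data.List.Relation.Binary.Permutation.Propositional using (_↭_)
open import Data.List.Relation.Unary.All using (All)
open import Data.Product using (Σ; _×_; _,_; proj₁; proj₂)
open import Relation.Binary.PropositionalEquality using (_≡_)
open import Relation.Nullary using (¬_)

-- Compositions.  s = (s_1,…,s_n) is a vector of length n with all
-- entries ≥ 1.  We use 1-based access:  at xs i = x_i  (0 if out of range).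

IsComposition : {n : ℕ} → Vec ℕ n → Set
IsComposition {n} s = (i : Fin n) → 1 ≤ Vec.lookup s i

at : List ℕ → ℕ → ℕ
at []       _             = 0
at (x ∷ xs) zero          = 0
at (x ∷ xs) (suc zero)    = x
at (x ∷ xs) (suc (suc i)) = at xs (suc i)

oneTo : ℕ → List ℕ
oneTo m = map suc (upTo m)

baseWord : {n : ℕ} → Vec ℕ n → List ℕ
baseWord {n} s = concatMap (λ i → replicate (at (Vec.toList s) i) i) (oneTo n)

Avoids121 : List ℕ → Set
Avoids121 w = (p q r : Fin (length w)) → p Fin.< q → q Fin.< r →
              lookup w p ≡ lookup w r → ¬ (lookup w p < lookup w q)

IsStirlingPerm : {n : ℕ} → Vec ℕ n → List ℕ → Set
IsStirlingPerm s w = (w ↭ baseWord s) × Avoids121 w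

StirlingPerm : {n : ℕ} → Vec ℕ n → Set
StirlingPerm s = Σ (List ℕ) (IsStirlingPerm s)

-- Vertex v_j (j = -1,0,…,n) is encoded by the natural number label j+1,
-- so labels are 0,1,…,n+1.  An edge is a pair (tail , head) of labels;
-- the multigraph is the list of its edges (parallel edges repeated).

sExt : {n : ℕ} → Vec ℕ n → List ℕ
sExt s = Vec.toList s ++ [ 2 ]

-- for i ∈ [n+1]: s_i - 1 source edges v_{-1} → v_{n+1-i}
sourceEdges : {n : ℕ} → Vec ℕ n → List (ℕ × ℕ)
sourceEdges {n} s =
  concatMap (λ i → replicate (at (sExt s) i ∸ 1) (0 , n + 2 ∸ i)) (oneTo (suc n))

-- for i ∈ [n]: bump and dip edges v_{n-i} → v_{n+1-i}
bumpDipEdges : {n : ℕ} → Vec ℕ n → List (ℕ × ℕ)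
bumpDipEdges {n} s =
  concatMap (λ i → (n + 1 ∸ i , n + 2 ∸ i) ∷ (n + 1 ∸ i , n + 2 ∸ i) ∷ []) (oneTo n)

oruga : {n : ℕ} → Vec ℕ n → List (ℕ × ℕ)
oruga s = sourceEdges s ++ bumpDipEdges s

-- The netflow d = (0, 0, s_n, s_{n-1}, …, s_2, -(s_2+⋯+s_n)) on
-- (v_{-1}, v_0, v_1, …, v_{n-1}, v_n), as a function of the vertex label.
-- (label j+1 for 1 ≤ j ≤ n-1 gets s_{n+1-j} = s_{n+2-label})

netflowD : {n : ℕ} → Vec ℕ n → ℕ → ℤ
netflowD s zero = + 0
netflowD s (suc zero) = + 0
netflowD {n} s k@(suc (suc _)) =
  if k ≡ᵇ suc n then - (+ sum (drop 1 (Vec.toList s)))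
  else + at (Vec.toList s) (n + 2 ∸ k)

outFlow : (E : List (ℕ × ℕ)) → List ℕ → ℕ → ℕ
outFlow E f v = sum (map (λ { ((t , h) , x) → if t ≡ᵇ v then x else 0 }) (zip E f))

inFlow : (E : List (ℕ × ℕ)) → List ℕ → ℕ → ℕ
inFlow E f v = sum (map (λ { ((t , h) , x) → if h ≡ᵇ v then x else 0 }) (zip E f))

IsIntFlow : (N : ℕ) (E : List (ℕ × ℕ)) (a : ℕ → ℤ) → Vec ℕ (length E) → Set
IsIntFlow N E a f = (v : ℕ) → v ≤ N →
  (+ outFlow E (Vec.toList f) v) ℤ.- (+ inFlow E (Vec.toList f) v) ≡ a v

IntDFlow : {n : ℕ} → Vec ℕ n → Set
IntDFlow {n} s = Σ (Vec ℕ (length (oruga s))) (IsIntFlow (suc n) (oruga s) (netflowD s))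

-- Bijection between two types carved out by properties, identifying
-- elements with equal underlying data (first components).

Bij : {A B : Set} (P : A → Set) (Q : B → Set) → Set
Bij {A} {B} P Q =
  Σ (Σ A P → Σ B Q) λ F →
  Σ (Σ B Q → Σ A P) λ G →
    ((x : Σ A P) → proj₁ (G (F x)) ≡ proj₁ x) ×
    ((y : Σ B Q) → proj₁ (F (G y)) ≡ proj₁ y)

-- Both sides are in bijection with the codes c = (c_1, …, c_n) satisfying
-- 0 ≤ c_i ≤ s_{i+1} + ⋯ + s_n.
--
-- A d-flow vanishes on the source edges, since v_{-1} has netflow 0 and no incoming edge.
-- Conservation then fixes the total flow through each pair of parallel edges: the pair
-- v_{n-i} → v_{n+1-i} carries s_{i+1} + ⋯ + s_n, split freely between bump and dip; c_i is
-- the flow on the dip edge.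
--
-- In a Stirling s-permutation the 1s form one block, since two 1s around a larger letter
-- would be a 121. Deleting the block and lowering every letter by one leaves a Stirling
-- (s_2, …, s_n)-permutation, of length s_2 + ⋯ + s_n, and c_1 is the position of the block;
-- conversely, inserting the block 1^{s_1} anywhere creates no 121.

{-# OPTIONS --safe #-}
module Submission where

open import Defs
open import Algebra.Bundles using (AbelianGroup)
open import Data.Bool using (true; false; if_then_else_)
open import Data.Empty using (⊥-elim)
open import Data.Fin as Fin using (Fin)
open import Data.Integer as ℤ using (ℤ; +_; -_)
import Data.Integer.Properties as ℤ
open import Algebra.Properties.Group (AbelianGroup.group ℤ.+-0-abelianGroup)
  using () renaming (∙-cancelʳ to +-cancelʳ)
open import Data.Integer.Tactic.RingSolver using (solve-∀)
open import Data.List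
  using (List; []; _∷_; _++_; map; filter; takeWhile; take; drop; replicate; length; lookup; concatMap; upTo)
open import Data.Nat
open import Data.List.Properties
open import Data.List.Relation.Binary.Permutation.Propositional using (_↭_; ↭-refl; ↭-sym; ↭-trans)
import Data.List.Relation.Binary.Permutation.Propositional.Properties as ↭
open import Data.List.Relation.Binary.Sublist.Propositional {A = ℕ}
  using (_⊆_; _∷_; _∷ʳ_; minimum; ⊆-refl; ⊆-trans)
import Data.List.Relation.Binary.Sublist.Propositional.Properties as ⊆
open import Data.List.Relation.Unary.All as All using (All; []; _∷_)
import Data.List.Relation.Unary.All.Properties as All
open import Data.Nat.ListAction using (sum)
open import Data.Nat.Properties
open import Data.Product using (∃-syntax; _×_; _,_; proj₁; proj₂)
open import Data.Sum using (inj₁; inj₂)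
open import Data.Vec as Vec using (Vec; []; _∷_)
import Data.Vec.Properties as Vecₚ
open import Function using (_∘_)
open import Relation.Binary.PropositionalEquality
open import Relation.Nullary using (¬_; yes; no)
open import Relation.Nullary.Decidable using (dec-true; dec-false)

record Correspondence {A B : Set} (P : A → Set) (Q : B → Set) : Set where
  field
    to        : A → B
    from      : B → A
    to-resp   : ∀ {x} → P x → Q (to x)
    from-resp : ∀ {y} → Q y → P (from y)
    from∘to   : ∀ {x} → P x → from (to x) ≡ x
    to∘from   : ∀ {y} → Q y → to (from y) ≡ y

Correspondence-trans : ∀ {A B C : Set} {P : A → Set} {Q : B → Set} {R : C → Set} →
                       Correspondence P Q → Correspondence Q R → Correspondence P R
Correspondence-trans F G = record
  { to        = G.to ∘ F.to
  ; from      = F.from ∘ G.from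
  ; to-resp   = G.to-resp ∘ F.to-resp
  ; from-resp = F.from-resp ∘ G.from-resp
  ; from∘to   = λ p → trans (cong F.from (G.from∘to (F.to-resp p))) (F.from∘to p)
  ; to∘from   = λ r → trans (cong G.to (F.to∘from (G.from-resp r))) (G.to∘from r)
  }
  where
  module F = Correspondence F
  module G = Correspondence G

Correspondence⇒Bij : ∀ {A B : Set} {P : A → Set} {Q : B → Set} → Correspondence P Q → Bij P Q
Correspondence⇒Bij C =
  (λ (x , p) → to x , to-resp p) ,
  (λ (y , q) → from y , from-resp q) ,
  (λ (_ , p) → from∘to p) ,
  (λ (_ , q) → to∘from q)
  where open Correspondence C

data Code : ∀ {n} → Vec ℕ n → List ℕ → Set where
  []  : Code [] []
  _∷_ : ∀ {n x p c} {s : Vec ℕ n} → p ≤ sum (Vec.toList s) → Code s c → Code (x ∷ s) (p ∷ c)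

≡ᵇ-refl : ∀ n → (n ≡ᵇ n) ≡ true
≡ᵇ-refl n = dec-true (n ≟ n) refl

≡ᵇ-false : ∀ {m n} → m ≢ n → (m ≡ᵇ n) ≡ false
≡ᵇ-false {m} {n} = dec-false (m ≟ n)

oneTo-suc : ∀ m → oneTo (suc m) ≡ 1 ∷ map suc (oneTo m)
oneTo-suc m = cong (λ l → 1 ∷ map suc l) (sym (map-applyUpTo (λ i → i) suc m))

-- Flows on the oruga graph

divergence : List (ℕ × ℕ) → List ℕ → ℕ → ℤ
divergence E f v = + outFlow E f v ℤ.- + inFlow E f v

outFlow-++ : ∀ A B x y v → length x ≡ length A →
             outFlow (A ++ B) (x ++ y) v ≡ outFlow A x v + outFlow B y v
outFlow-++ []      B []       y v _  = refl
outFlow-++ (e ∷ A) B (x ∷ xs) y v eq =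
  trans (cong (_+_ o) (outFlow-++ A B xs y v (suc-injective eq))) (sym (+-assoc o _ _))
  where o = if proj₁ e ≡ᵇ v then x else 0

inFlow-++ : ∀ A B x y v → length x ≡ length A →
            inFlow (A ++ B) (x ++ y) v ≡ inFlow A x v + inFlow B y v
inFlow-++ []      B []       y v _  = refl
inFlow-++ (e ∷ A) B (x ∷ xs) y v eq =
  trans (cong (_+_ i) (inFlow-++ A B xs y v (suc-injective eq))) (sym (+-assoc i _ _))
  where i = if proj₂ e ≡ᵇ v then x else 0

divergence-++ : ∀ A B x y v → length x ≡ length A →
                divergence (A ++ B) (x ++ y) v ≡ divergence A x v ℤ.+ divergence B y v
divergence-++ A B x y v eq =
  trans (cong₂ (λ o i → + o ℤ.- + i) (outFlow-++ A B x y v eq) (inFlow-++ A B x y v eq))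
        (regroup (outFlow A x v) (outFlow B y v) (inFlow A x v) (inFlow B y v))
  where
  regroup : ∀ a b c d → + (a + b) ℤ.- + (c + d) ≡ (+ a ℤ.- + c) ℤ.+ (+ b ℤ.- + d)
  regroup a b c d rewrite ℤ.pos-+ a b | ℤ.pos-+ c d = ring (+ a) (+ b) (+ c) (+ d)
    where
    ring : ∀ a b c d → (a ℤ.+ b) ℤ.- (c ℤ.+ d) ≡ (a ℤ.- c) ℤ.+ (b ℤ.- d)
    ring = solve-∀

outFlow-untouched : ∀ {v} E → All (λ e → proj₁ e ≢ v) E → ∀ f → outFlow E f v ≡ 0
outFlow-untouched []      _          f       = refl
outFlow-untouched (e ∷ E) _          []      = refl
outFlow-untouched (e ∷ E) (t≢v ∷ ps) (x ∷ f) rewrite ≡ᵇ-false t≢v = outFlow-untouched E ps f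

inFlow-untouched : ∀ {v} E → All (λ e → proj₂ e ≢ v) E → ∀ f → inFlow E f v ≡ 0
inFlow-untouched []      _          f       = refl
inFlow-untouched (e ∷ E) _          []      = refl
inFlow-untouched (e ∷ E) (h≢v ∷ ps) (x ∷ f) rewrite ≡ᵇ-false h≢v = inFlow-untouched E ps f

divergence-untouched : ∀ {v} E → All (λ e → proj₁ e ≢ v × proj₂ e ≢ v) E → ∀ f →
                       divergence E f v ≡ + 0
divergence-untouched E ps f
  rewrite outFlow-untouched E (All.map proj₁ ps) f | inFlow-untouched E (All.map proj₂ ps) f = refl

IsSourceEdge : ℕ × ℕ → Set
IsSourceEdge (t , h) = t ≡ 0 × h ≢ 0

sourceEdges-areSource : ∀ {n} (s : Vec ℕ n) → All IsSourceEdge (sourceEdges s)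
sourceEdges-areSource {n} s =
  All.concat⁺ (All.map⁺ (All.map⁺ (All.applyUpTo⁺₁ (λ i → i) (suc n) (λ i<1+n →
    All.replicate⁺ _ (refl , m>n⇒m∸n≢0 (≤-trans (s≤s i<1+n) (≤-reflexive (+-comm 2 n))))))))

outFlow-sources-at-0 : ∀ A → All IsSourceEdge A → ∀ x → length x ≡ length A →
                       outFlow A x 0 ≡ sum x
outFlow-sources-at-0 []              _                []       _  = refl
outFlow-sources-at-0 ((.0 , h) ∷ A) ((refl , _) ∷ ps) (x ∷ xs) eq =
  cong (_+_ x) (outFlow-sources-at-0 A ps xs (suc-injective eq))

divergence-sources-at-0 : ∀ A → All IsSourceEdge A → ∀ x → length x ≡ length A →
                          divergence A x 0 ≡ + sum x
divergence-sources-at-0 A ps x eq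
  rewrite outFlow-sources-at-0 A ps x eq | inFlow-untouched A (All.map proj₂ ps) x =
  ℤ.+-identityʳ (+ sum x)

outFlow-zeros : ∀ E k v → outFlow E (replicate k 0) v ≡ 0
outFlow-zeros []      k       v = refl
outFlow-zeros (e ∷ E) zero    v = refl
outFlow-zeros (e ∷ E) (suc k) v with proj₁ e ≡ᵇ v
... | true  = outFlow-zeros E k v
... | false = outFlow-zeros E k v

inFlow-zeros : ∀ E k v → inFlow E (replicate k 0) v ≡ 0
inFlow-zeros []      k       v = refl
inFlow-zeros (e ∷ E) zero    v = refl
inFlow-zeros (e ∷ E) (suc k) v with proj₂ e ≡ᵇ v
... | true  = inFlow-zeros E k v
... | false = inFlow-zeros E k v

divergence-zeros : ∀ E k v → divergence E (replicate k 0) v ≡ + 0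
divergence-zeros E k v rewrite outFlow-zeros E k v | inFlow-zeros E k v = refl

rung : ℕ → List (ℕ × ℕ)
rung t = (t , suc t) ∷ (t , suc t) ∷ []

ladder : ℕ → List (ℕ × ℕ)
ladder zero    = []
ladder (suc m) = rung (suc m) ++ ladder m

bumpDipEdges≡ladder : ∀ {n} (s : Vec ℕ n) → bumpDipEdges s ≡ ladder n
bumpDipEdges≡ladder {n} _ = rungs n
  where
  rungs : ∀ n →
    concatMap (λ i → (n + 1 ∸ i , n + 2 ∸ i) ∷ (n + 1 ∸ i , n + 2 ∸ i) ∷ []) (oneTo n) ≡ ladder n
  rungs zero    = refl
  rungs (suc m) = begin
    concatMap f (oneTo (suc m))                    ≡⟨ cong (concatMap f) (oneTo-suc m) ⟩
    f 1 ++ concatMap f (map suc (oneTo m))         ≡⟨ cong₂ _++_ top (concatMap-map f suc (oneTo m)) ⟩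
    rung (suc m) ++ concatMap (f ∘ suc) (oneTo m)  ≡⟨ cong (rung (suc m) ++_) (rungs m) ⟩
    rung (suc m) ++ ladder m                       ∎
    where
    open ≡-Reasoning
    f : ℕ → List (ℕ × ℕ)
    f i = (suc m + 1 ∸ i , suc m + 2 ∸ i) ∷ (suc m + 1 ∸ i , suc m + 2 ∸ i) ∷ []
    top : f 1 ≡ rung (suc m)
    top rewrite +-comm m 1 | +-comm m 2 = refl

ladder-edges : ∀ m → All (λ (t , h) → 0 < t × t < h × h ≤ suc m) (ladder m)
ladder-edges zero    = []
ladder-edges (suc m) =
  top ∷ top ∷ All.map (λ (0<t , t<h , h≤1+m) → 0<t , t<h , m≤n⇒m≤1+n h≤1+m) (ladder-edges m)
  where top = z<s , n<1+n (suc m) , ≤-refl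

divergence-ladder-at-0 : ∀ m g → divergence (ladder m) g 0 ≡ + 0
divergence-ladder-at-0 m = divergence-untouched (ladder m)
  (All.map (λ (0<t , t<h , _) → >⇒≢ 0<t , >⇒≢ (<-trans 0<t t<h)) (ladder-edges m))

divergence-ladder-above : ∀ m g → divergence (ladder m) g (suc (suc m)) ≡ + 0
divergence-ladder-above m = divergence-untouched (ladder m)
  (All.map (λ (_ , t<h , h≤1+m) → <⇒≢ (<-trans t<h (s≤s h≤1+m)) , <⇒≢ (s≤s h≤1+m)) (ladder-edges m))

divergence-rung-at-tail : ∀ t b d → divergence (rung t) (b ∷ d ∷ []) t ≡ + (b + d)
divergence-rung-at-tail t b d rewrite ≡ᵇ-refl t | ≡ᵇ-false (1+n≢n {t}) | +-identityʳ d =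
  ℤ.+-identityʳ (+ (b + d))

divergence-rung-at-head : ∀ t b d → divergence (rung t) (b ∷ d ∷ []) (suc t) ≡ - + (b + d)
divergence-rung-at-head t b d rewrite ≡ᵇ-refl t | ≡ᵇ-false (≢-sym (1+n≢n {t})) | +-identityʳ d =
  ℤ.+-identityˡ (- + (b + d))

divergence-rung-elsewhere : ∀ {t v} b d → v ≢ t → v ≢ suc t →
                            divergence (rung t) (b ∷ d ∷ []) v ≡ + 0
divergence-rung-elsewhere b d v≢t v≢1+t =
  divergence-untouched (rung _) (untouched ∷ untouched ∷ []) (b ∷ d ∷ [])
  where untouched = ≢-sym v≢t , ≢-sym v≢1+t

divergence-ladder-∷ : ∀ m b d g v →
  divergence (ladder (suc m)) (b ∷ d ∷ g) v ≡
  divergence (rung (suc m)) (b ∷ d ∷ []) v ℤ.+ divergence (ladder m) g v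
divergence-ladder-∷ m b d g v = divergence-++ (rung (suc m)) (ladder m) (b ∷ d ∷ []) g v refl

at-∷ : ∀ x xs {j} → 0 < j → at (x ∷ xs) (suc j) ≡ at xs j
at-∷ x xs {suc j} _ = refl

netflowD-∷-below : ∀ {m} x (s : Vec ℕ m) {v} → v ≤ m → netflowD (x ∷ s) v ≡ netflowD s v
netflowD-∷-below x s {zero}        _ = refl
netflowD-∷-below x s {suc zero}    _ = refl
netflowD-∷-below {m} x s {suc (suc k)} 2+k≤m
  rewrite ≡ᵇ-false (<⇒≢ (≤-trans (n≤1+n (suc k)) 2+k≤m)) | ≡ᵇ-false (<⇒≢ 2+k≤m) =
  cong +_ (begin
    at (x ∷ xs) (suc m + 2 ∸ suc (suc k))    ≡⟨ cong (at (x ∷ xs)) (+-∸-assoc 1 (<⇒≤ 2+k<m+2)) ⟩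
    at (x ∷ xs) (suc (m + 2 ∸ suc (suc k)))  ≡⟨ at-∷ x xs (m<n⇒0<n∸m 2+k<m+2) ⟩
    at xs (m + 2 ∸ suc (suc k))              ∎)
  where
  open ≡-Reasoning
  xs = Vec.toList s
  2+k<m+2 : suc (suc k) < m + 2
  2+k<m+2 = ≤-<-trans 2+k≤m (m<m+n m z<s)

netflowD-∷-sink : ∀ {m} x (s : Vec ℕ m) → netflowD (x ∷ s) (suc (suc m)) ≡ - + sum (Vec.toList s)
netflowD-∷-sink {m} x s rewrite ≡ᵇ-refl m = refl

netflowD-∷-top : ∀ {m} x (s : Vec ℕ m) →
                 netflowD (x ∷ s) (suc m) ≡ netflowD s (suc m) ℤ.+ + sum (Vec.toList s)
netflowD-∷-top x []                = refl
netflowD-∷-top {suc m} x (y ∷ s) rewrite ≡ᵇ-false (≢-sym (1+n≢n {m})) | m+n∸m≡n m 2 = begin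
  + y                                            ≡⟨ ring (+ y) (+ Σs) ⟩
  - + Σs ℤ.+ (+ y ℤ.+ + Σs)                      ≡⟨ cong₂ ℤ._+_ (netflowD-∷-sink y s) (ℤ.pos-+ y Σs) ⟨
  netflowD (y ∷ s) (suc (suc m)) ℤ.+ + (y + Σs)  ∎
  where
  open ≡-Reasoning
  Σs = sum (Vec.toList s)
  ring : ∀ a b → a ≡ - b ℤ.+ (a ℤ.+ b)
  ring = solve-∀

divergence-ladder-∷-below : ∀ {m} b d g {v} → v ≤ m →
  divergence (ladder (suc m)) (b ∷ d ∷ g) v ≡ divergence (ladder m) g v
divergence-ladder-∷-below {m} b d g {v} v≤m = begin
  divergence (ladder (suc m)) (b ∷ d ∷ g) v
    ≡⟨ divergence-ladder-∷ m b d g v ⟩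
  top ℤ.+ rest
    ≡⟨ cong (ℤ._+ rest) (divergence-rung-elsewhere b d v≢1+m v≢2+m) ⟩
  + 0 ℤ.+ rest
    ≡⟨ ℤ.+-identityˡ rest ⟩
  rest
    ∎
  where
  open ≡-Reasoning
  top   = divergence (rung (suc m)) (b ∷ d ∷ []) v
  rest  = divergence (ladder m) g v
  v≢1+m = <⇒≢ (s≤s v≤m)
  v≢2+m = <⇒≢ (m<n⇒m<1+n (s≤s v≤m))

divergence-ladder-∷-top : ∀ m b d g →
  divergence (ladder (suc m)) (b ∷ d ∷ g) (suc m) ≡ divergence (ladder m) g (suc m) ℤ.+ + (b + d)
divergence-ladder-∷-top m b d g = begin
  divergence (ladder (suc m)) (b ∷ d ∷ g) (suc m)
    ≡⟨ divergence-ladder-∷ m b d g (suc m) ⟩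
  top ℤ.+ rest
    ≡⟨ cong (ℤ._+ rest) (divergence-rung-at-tail (suc m) b d) ⟩
  + (b + d) ℤ.+ rest
    ≡⟨ ℤ.+-comm (+ (b + d)) rest ⟩
  rest ℤ.+ + (b + d)
    ∎
  where
  open ≡-Reasoning
  top  = divergence (rung (suc m)) (b ∷ d ∷ []) (suc m)
  rest = divergence (ladder m) g (suc m)

divergence-ladder-∷-sink : ∀ m b d g →
  divergence (ladder (suc m)) (b ∷ d ∷ g) (suc (suc m)) ≡ - + (b + d)
divergence-ladder-∷-sink m b d g = begin
  divergence (ladder (suc m)) (b ∷ d ∷ g) (suc (suc m))
    ≡⟨ divergence-ladder-∷ m b d g (suc (suc m)) ⟩
  top ℤ.+ rest
    ≡⟨ cong₂ ℤ._+_ (divergence-rung-at-head (suc m) b d) (divergence-ladder-above m g) ⟩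
  - + (b + d) ℤ.+ + 0
    ≡⟨ ℤ.+-identityʳ _ ⟩
  - + (b + d)
    ∎
  where
  open ≡-Reasoning
  top  = divergence (rung (suc m)) (b ∷ d ∷ []) (suc (suc m))
  rest = divergence (ladder m) g (suc (suc m))

LadderFlow : ∀ {n} → Vec ℕ n → List ℕ → Set
LadderFlow {n} s g = ∀ v → v ≤ suc n → divergence (ladder n) g v ≡ netflowD s v

ladderFlow-[] : LadderFlow [] []
ladderFlow-[] zero       _ = refl
ladderFlow-[] (suc zero) _ = refl
ladderFlow-[] (suc (suc v)) (s≤s ())

ladderFlow-∷⁺ : ∀ {m} x (s : Vec ℕ m) b d g →
                b + d ≡ sum (Vec.toList s) → LadderFlow s g → LadderFlow (x ∷ s) (b ∷ d ∷ g)
ladderFlow-∷⁺ {m} x s b d g b+d≡Σs flow v v≤2+m with m≤n⇒m<n∨m≡n v≤2+m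
... | inj₂ refl = trans (divergence-ladder-∷-sink m b d g)
                    (trans (cong (-_ ∘ +_) b+d≡Σs) (sym (netflowD-∷-sink x s)))
... | inj₁ (s≤s v≤1+m) with m≤n⇒m<n∨m≡n v≤1+m
...   | inj₂ refl = trans (divergence-ladder-∷-top m b d g)
                      (trans (cong₂ ℤ._+_ (flow (suc m) ≤-refl) (cong +_ b+d≡Σs)) (sym (netflowD-∷-top x s)))
...   | inj₁ (s≤s v≤m) = trans (divergence-ladder-∷-below b d g v≤m)
                           (trans (flow v v≤1+m) (sym (netflowD-∷-below x s v≤m)))

ladderFlow-∷⁻ : ∀ {m} x (s : Vec ℕ m) b d g →
                LadderFlow (x ∷ s) (b ∷ d ∷ g) → b + d ≡ sum (Vec.toList s) × LadderFlow s g
ladderFlow-∷⁻ {m} x s b d g flow = b+d≡Σs , flow′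
  where
  open ≡-Reasoning
  Σs = sum (Vec.toList s)
  b+d≡Σs : b + d ≡ Σs
  b+d≡Σs = ℤ.+-injective (ℤ.neg-injective (begin
    - + (b + d)                                            ≡⟨ divergence-ladder-∷-sink m b d g ⟨
    divergence (ladder (suc m)) (b ∷ d ∷ g) (suc (suc m))  ≡⟨ flow (suc (suc m)) ≤-refl ⟩
    netflowD (x ∷ s) (suc (suc m))                         ≡⟨ netflowD-∷-sink x s ⟩
    - + Σs                                                 ∎))
  flow′ : LadderFlow s g
  flow′ v v≤1+m with m≤n⇒m<n∨m≡n v≤1+m
  ... | inj₁ (s≤s v≤m) = trans (sym (divergence-ladder-∷-below b d g v≤m))
                           (trans (flow v (m≤n⇒m≤1+n v≤1+m)) (netflowD-∷-below x s v≤m))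
  ... | inj₂ refl = +-cancelʳ (+ Σs) _ _ (begin
    rest ℤ.+ + Σs                                    ≡⟨ cong (λ t → rest ℤ.+ + t) b+d≡Σs ⟨
    rest ℤ.+ + (b + d)                               ≡⟨ divergence-ladder-∷-top m b d g ⟨
    divergence (ladder (suc m)) (b ∷ d ∷ g) (suc m)  ≡⟨ flow (suc m) (n≤1+n _) ⟩
    netflowD (x ∷ s) (suc m)                         ≡⟨ netflowD-∷-top x s ⟩
    netflowD s (suc m) ℤ.+ + Σs                      ∎)
    where rest = divergence (ladder m) g (suc m)

-- The clauses for a code shorter than s are junk, only there to make the function total.
ladderOf : ∀ {n} → Vec ℕ n → List ℕ → List ℕ
ladderOf []      _       = []
ladderOf (x ∷ s) []      = 0 ∷ 0 ∷ ladderOf s []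
ladderOf (x ∷ s) (p ∷ c) = sum (Vec.toList s) ∸ p ∷ p ∷ ladderOf s c

dips : List ℕ → List ℕ
dips (b ∷ d ∷ g) = d ∷ dips g
dips _           = []

length-ladderOf : ∀ {n} (s : Vec ℕ n) c → length (ladderOf s c) ≡ length (ladder n)
length-ladderOf []      _       = refl
length-ladderOf (x ∷ s) []      = cong (suc ∘ suc) (length-ladderOf s [])
length-ladderOf (x ∷ s) (p ∷ c) = cong (suc ∘ suc) (length-ladderOf s c)

ladderOf-isLadderFlow : ∀ {n} {s : Vec ℕ n} {c} → Code s c → LadderFlow s (ladderOf s c)
ladderOf-isLadderFlow []                       = ladderFlow-[]
ladderOf-isLadderFlow {s = x ∷ s} (p≤Σs ∷ code) =
  ladderFlow-∷⁺ x s _ _ _ (m∸n+n≡m p≤Σs) (ladderOf-isLadderFlow code)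

dips-ladderOf : ∀ {n} {s : Vec ℕ n} {c} → Code s c → dips (ladderOf s c) ≡ c
dips-ladderOf []                = refl
dips-ladderOf {c = p ∷ _} (_ ∷ code) = cong (p ∷_) (dips-ladderOf code)

ladderFlow⇒code : ∀ {n} (s : Vec ℕ n) g → length g ≡ length (ladder n) → LadderFlow s g →
                  Code s (dips g) × ladderOf s (dips g) ≡ g
ladderFlow⇒code []      []          _   _    = [] , refl
ladderFlow⇒code (x ∷ s) (b ∷ d ∷ g) len flow with ladderFlow-∷⁻ x s b d g flow
... | b+d≡Σs , flow′ with ladderFlow⇒code s g (suc-injective (suc-injective len)) flow′
...   | code , ladderOf≡g =
  subst (d ≤_) b+d≡Σs (m≤n+m d b) ∷ code ,
  cong₂ (λ b′ g′ → b′ ∷ d ∷ g′) (trans (cong (_∸ d) (sym b+d≡Σs)) (m+n∸n≡m b d)) ladderOf≡g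

IsFlowList : ∀ {n} → Vec ℕ n → List ℕ → Set
IsFlowList {n} s l = ∀ v → v ≤ suc n → divergence (oruga s) l v ≡ netflowD s v

sum≡0⇒zeros : ∀ xs → sum xs ≡ 0 → xs ≡ replicate (length xs) 0
sum≡0⇒zeros []       _    = refl
sum≡0⇒zeros (x ∷ xs) Σ≡0 rewrite m+n≡0⇒m≡0 x Σ≡0 =
  cong (0 ∷_) (sum≡0⇒zeros xs (m+n≡0⇒n≡0 x Σ≡0))

module _ {n} (s : Vec ℕ n) where

  private
    k = length (sourceEdges s)

  length-oruga : length (oruga s) ≡ k + length (ladder n)
  length-oruga = trans (length-++ (sourceEdges s)) (cong (λ E → k + length E) (bumpDipEdges≡ladder s))

  divergence-oruga : ∀ z g v → length z ≡ k →
    divergence (oruga s) (z ++ g) v ≡ divergence (sourceEdges s) z v ℤ.+ divergence (ladder n) g v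
  divergence-oruga z g v len rewrite sym (bumpDipEdges≡ladder s) =
    divergence-++ (sourceEdges s) (bumpDipEdges s) z g v len

  divergence-oruga-zeros : ∀ g v →
    divergence (oruga s) (replicate k 0 ++ g) v ≡ divergence (ladder n) g v
  divergence-oruga-zeros g v = begin
    divergence (oruga s) (replicate k 0 ++ g) v       ≡⟨ divergence-oruga _ g v (length-replicate k) ⟩
    divergence (sourceEdges s) (replicate k 0) v ℤ.+ rest
                                                      ≡⟨ cong (ℤ._+ rest) (divergence-zeros (sourceEdges s) k v) ⟩
    + 0 ℤ.+ rest                                      ≡⟨ ℤ.+-identityˡ rest ⟩
    rest                                              ∎
    where
    open ≡-Reasoning
    rest = divergence (ladder n) g v

  flow-vanishes-on-sources : ∀ z g → length z ≡ k → IsFlowList s (z ++ g) → z ≡ replicate k 0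
  flow-vanishes-on-sources z g len flow =
    trans (sum≡0⇒zeros z (ℤ.+-injective Σz≡0)) (cong (λ j → replicate j 0) len)
    where
    open ≡-Reasoning
    Σz≡0 : + sum z ≡ + 0
    Σz≡0 = begin
      + sum z                                                       ≡⟨ ℤ.+-identityʳ _ ⟨
      + sum z ℤ.+ + 0
        ≡⟨ cong₂ ℤ._+_ (divergence-sources-at-0 (sourceEdges s) (sourceEdges-areSource s) z len)
                       (divergence-ladder-at-0 n g) ⟨
      divergence (sourceEdges s) z 0 ℤ.+ divergence (ladder n) g 0 ≡⟨ divergence-oruga z g 0 len ⟨
      divergence (oruga s) (z ++ g) 0                               ≡⟨ flow 0 z≤n ⟩
      + 0                                                           ∎

  ladderFlow⇒flowList : ∀ {g} → LadderFlow s g → IsFlowList s (replicate k 0 ++ g)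
  ladderFlow⇒flowList {g} flow v v≤1+n = trans (divergence-oruga-zeros g v) (flow v v≤1+n)

  flowList⇒ladderFlow : ∀ l → length l ≡ length (oruga s) → IsFlowList s l →
                        l ≡ replicate k 0 ++ drop k l × length (drop k l) ≡ length (ladder n) ×
                        LadderFlow s (drop k l)
  flowList⇒ladderFlow l len flow = l≡0++g , length-g , ladderFlow
    where
    g = drop k l
    length-take-k : length (take k l) ≡ k
    length-take-k = trans (length-take k l)
      (m≤n⇒m⊓n≡m (subst (k ≤_) (sym (trans len length-oruga)) (m≤m+n k _)))
    length-g : length g ≡ length (ladder n)
    length-g = trans (length-drop k l) (trans (cong (_∸ k) (trans len length-oruga)) (m+n∸m≡n k _))
    l≡0++g : l ≡ replicate k 0 ++ g
    l≡0++g = trans (sym (take++drop≡id k l)) (cong (_++ g)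
      (flow-vanishes-on-sources (take k l) g length-take-k
        (subst (IsFlowList s) (sym (take++drop≡id k l)) flow)))
    ladderFlow : LadderFlow s g
    ladderFlow v v≤1+n = trans (sym (divergence-oruga-zeros g v))
      (subst (λ l → divergence (oruga s) l v ≡ netflowD s v) l≡0++g (flow v v≤1+n))

drop-replicate-++ : ∀ k (x : ℕ) ys → drop k (replicate k x ++ ys) ≡ ys
drop-replicate-++ zero    x ys = refl
drop-replicate-++ (suc k) x ys = drop-replicate-++ k x ys

toList-injective : ∀ {n} {xs ys : Vec ℕ n} → Vec.toList xs ≡ Vec.toList ys → xs ≡ ys
toList-injective {xs = xs} {ys} eq =
  trans (sym (Vecₚ.cast-is-id refl xs)) (Vecₚ.toList-injective refl xs ys eq)

codes≈flows : ∀ {n} (s : Vec ℕ n) → Correspondence (Code s) (IsIntFlow (suc n) (oruga s) (netflowD s))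
codes≈flows {n} s = record
  { to        = flowOf
  ; from      = codeOfFlow
  ; to-resp   = λ code →
      subst (IsFlowList s) (sym (toList-flowOf _)) (ladderFlow⇒flowList s (ladderOf-isLadderFlow code))
  ; from-resp = λ flow → proj₁ (decode flow)
  ; from∘to   = λ {c} code → begin
      dips (drop k (Vec.toList (flowOf c)))          ≡⟨ cong (dips ∘ drop k) (toList-flowOf c) ⟩
      dips (drop k (replicate k 0 ++ ladderOf s c))  ≡⟨ cong dips (drop-replicate-++ k 0 _) ⟩
      dips (ladderOf s c)                            ≡⟨ dips-ladderOf code ⟩
      c                                              ∎
  ; to∘from   = λ flow → toList-injective (proj₂ (decode flow))
  }
  where
  open ≡-Reasoning
  k = length (sourceEdges s)
  length-flowList : ∀ c → length (replicate k 0 ++ ladderOf s c) ≡ length (oruga s)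
  length-flowList c = trans (length-++ (replicate k 0))
    (trans (cong₂ _+_ (length-replicate k) (length-ladderOf s c)) (sym (length-oruga s)))
  flowOf : List ℕ → Vec ℕ (length (oruga s))
  flowOf c = Vec.cast (length-flowList c) (Vec.fromList (replicate k 0 ++ ladderOf s c))
  toList-flowOf : ∀ c → Vec.toList (flowOf c) ≡ replicate k 0 ++ ladderOf s c
  toList-flowOf c = trans (Vecₚ.toList-cast _ _) (Vecₚ.toList∘fromList _)
  codeOfFlow : Vec ℕ (length (oruga s)) → List ℕ
  codeOfFlow f = dips (drop k (Vec.toList f))
  decode : ∀ {f} → IsIntFlow (suc n) (oruga s) (netflowD s) f →
           Code s (codeOfFlow f) × Vec.toList (flowOf (codeOfFlow f)) ≡ Vec.toList f
  decode {f} flow with flowList⇒ladderFlow s (Vec.toList f) (Vecₚ.length-toList f) flow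
  ... | l≡0++g , length-g , ladderFlow with ladderFlow⇒code s _ length-g ladderFlow
  ...   | code , ladderOf≡g =
    code , trans (toList-flowOf _) (trans (cong (replicate k 0 ++_) ladderOf≡g) (sym l≡0++g))

-- Stirling permutations

-- Sublists transport along map, filter and insertion more easily than the positions in Avoids121.
Has121 : List ℕ → Set
Has121 w = ∃[ a ] ∃[ b ] a < b × a ∷ b ∷ a ∷ [] ⊆ w

lookup₁-⊆ : ∀ w (r : Fin (length w)) → lookup w r ∷ [] ⊆ w
lookup₁-⊆ (x ∷ w) Fin.zero    = refl ∷ minimum w
lookup₁-⊆ (x ∷ w) (Fin.suc r) = x ∷ʳ lookup₁-⊆ w r

lookup₂-⊆ : ∀ w {q r : Fin (length w)} → q Fin.< r → lookup w q ∷ lookup w r ∷ [] ⊆ w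
lookup₂-⊆ (x ∷ w) {Fin.zero}  {Fin.suc r} _         = refl ∷ lookup₁-⊆ w r
lookup₂-⊆ (x ∷ w) {Fin.suc q} {Fin.suc r} (s≤s q<r) = x ∷ʳ lookup₂-⊆ w q<r

lookup₃-⊆ : ∀ w {p q r : Fin (length w)} → p Fin.< q → q Fin.< r →
            lookup w p ∷ lookup w q ∷ lookup w r ∷ [] ⊆ w
lookup₃-⊆ (x ∷ w) {Fin.zero}  {Fin.suc q} {Fin.suc r} _         (s≤s q<r) = refl ∷ lookup₂-⊆ w q<r
lookup₃-⊆ (x ∷ w) {Fin.suc p} {Fin.suc q} {Fin.suc r} (s≤s p<q) (s≤s q<r) = x ∷ʳ lookup₃-⊆ w p<q q<r

⊆-lookup₁ : ∀ {a w} → a ∷ [] ⊆ w → ∃[ r ] lookup w r ≡ a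
⊆-lookup₁ (y ∷ʳ τ)    = let r , eq = ⊆-lookup₁ τ in Fin.suc r , eq
⊆-lookup₁ (refl ∷ _) = Fin.zero , refl

⊆-lookup₂ : ∀ {a b w} → a ∷ b ∷ [] ⊆ w →
  ∃[ q ] ∃[ r ] q Fin.< r × lookup w q ≡ a × lookup w r ≡ b
⊆-lookup₂ (y ∷ʳ τ)    = let q , r , q<r , eqs = ⊆-lookup₂ τ in Fin.suc q , Fin.suc r , s≤s q<r , eqs
⊆-lookup₂ (refl ∷ τ) = let r , eq = ⊆-lookup₁ τ in Fin.zero , Fin.suc r , z<s , refl , eq

⊆-lookup₃ : ∀ {a b c w} → a ∷ b ∷ c ∷ [] ⊆ w →
  ∃[ p ] ∃[ q ] ∃[ r ] p Fin.< q × q Fin.< r × lookup w p ≡ a × lookup w q ≡ b × lookup w r ≡ c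
⊆-lookup₃ (y ∷ʳ τ)    = let p , q , r , p<q , q<r , eqs = ⊆-lookup₃ τ in
  Fin.suc p , Fin.suc q , Fin.suc r , s≤s p<q , s≤s q<r , eqs
⊆-lookup₃ (refl ∷ τ) = let q , r , q<r , eqs = ⊆-lookup₂ τ in
  Fin.zero , Fin.suc q , Fin.suc r , z<s , s≤s q<r , refl , eqs

avoids121⇒¬has121 : ∀ {w} → Avoids121 w → ¬ Has121 w
avoids121⇒¬has121 avoids (a , b , a<b , τ) with ⊆-lookup₃ τ
... | p , q , r , p<q , q<r , refl , refl , wr≡wp = avoids p q r p<q q<r (sym wr≡wp) a<b

¬has121⇒avoids121 : ∀ {w} → ¬ Has121 w → Avoids121 w
¬has121⇒avoids121 {w} no121 p q r p<q q<r wp≡wr wp<wq =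
  no121 (lookup w p , lookup w q , wp<wq ,
         subst (λ c → lookup w p ∷ lookup w q ∷ c ∷ [] ⊆ w) (sym wp≡wr) (lookup₃-⊆ w p<q q<r))

baseWord-∷ : ∀ {m} x (s : Vec ℕ m) → baseWord (x ∷ s) ≡ replicate x 1 ++ map suc (baseWord s)
baseWord-∷ {m} x s = trans (cong (concatMap g) (oneTo-suc m)) (cong (replicate x 1 ++_) (begin
  concatMap g (map suc (oneTo m))
    ≡⟨ concatMap-map g suc (oneTo m) ⟩
  concatMap (g ∘ suc) (map suc (upTo m))
    ≡⟨ concatMap-map (g ∘ suc) suc (upTo m) ⟩
  concatMap (g ∘ suc ∘ suc) (upTo m)
    ≡⟨ concatMap-cong (λ j → map-replicate suc (at xs (suc j)) (suc j)) (upTo m) ⟨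
  concatMap (map suc ∘ g′ ∘ suc) (upTo m)
    ≡⟨ concatMap-map (map suc ∘ g′) suc (upTo m) ⟨
  concatMap (map suc ∘ g′) (oneTo m)
    ≡⟨ map-concatMap suc g′ (oneTo m) ⟨
  map suc (baseWord s)
    ∎))
  where
  open ≡-Reasoning
  xs = Vec.toList s
  g g′ : ℕ → List ℕ
  g  i = replicate (at (x ∷ xs) i) i
  g′ i = replicate (at xs i) i

length-baseWord : ∀ {n} (s : Vec ℕ n) → length (baseWord s) ≡ sum (Vec.toList s)
length-baseWord []      = refl
length-baseWord (x ∷ s)
  rewrite baseWord-∷ x s | length-++ (replicate x 1) {map suc (baseWord s)}
        | length-replicate x {1} | length-map suc (baseWord s) = cong (_+_ x) (length-baseWord s)

map-suc-big : ∀ {xs} → All (0 <_) xs → All (1 <_) (map suc xs)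
map-suc-big = All.map⁺ ∘ All.map s≤s

map-suc-positive : ∀ xs → All (0 <_) (map suc xs)
map-suc-positive xs = All.map⁺ (All.universal (λ _ → z<s) xs)

baseWord-positive : ∀ {n} (s : Vec ℕ n) → All (0 <_) (baseWord s)
baseWord-positive []      = []
baseWord-positive (x ∷ s) rewrite baseWord-∷ x s =
  All.++⁺ (All.replicate⁺ x z<s) (map-suc-positive (baseWord s))

map-pred-suc : ∀ xs → map pred (map suc xs) ≡ xs
map-pred-suc xs = trans (sym (map-∘ xs)) (map-id xs)

big⇒map-suc-pred : ∀ {xs} → All (1 <_) xs → map suc (map pred xs) ≡ xs
big⇒map-suc-pred []                   = refl
big⇒map-suc-pred {suc x ∷ xs} (_ ∷ ps) = cong (suc x ∷_) (big⇒map-suc-pred ps)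

dropOnes : List ℕ → List ℕ
dropOnes = filter (1 <?_)

onesStart : List ℕ → ℕ
onesStart w = length (takeWhile (1 <?_) w)

dropOnes-block : ∀ {u v} k → All (1 <_) u → All (1 <_) v →
                 dropOnes (u ++ replicate k 1 ++ v) ≡ u ++ v
dropOnes-block {u} {v} k bigU bigV = begin
  dropOnes (u ++ ones ++ v)                  ≡⟨ filter-++ (1 <?_) u _ ⟩
  dropOnes u ++ dropOnes (ones ++ v)         ≡⟨ cong (dropOnes u ++_) (filter-++ (1 <?_) ones v) ⟩
  dropOnes u ++ dropOnes ones ++ dropOnes v  ≡⟨ cong₂ (λ u′ r → u′ ++ r ++ dropOnes v) u-kept ones-dropped ⟩
  u ++ dropOnes v                            ≡⟨ cong (u ++_) (filter-all (1 <?_) bigV) ⟩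
  u ++ v                                     ∎
  where
  open ≡-Reasoning
  ones = replicate k 1
  u-kept = filter-all (1 <?_) bigU
  ones-dropped = filter-none (1 <?_) (All.replicate⁺ k (n≮n 1))

onesStart-block : ∀ {u} k v → All (1 <_) u → onesStart (u ++ replicate (suc k) 1 ++ v) ≡ length u
onesStart-block k v []              = refl
onesStart-block {x ∷ u} k v (1<x ∷ bigU) rewrite dec-true (1 <? x) 1<x =
  cong suc (onesStart-block k v bigU)

⊆-skip-prefix : ∀ {x xs} u {r} → All (_≢ x) u → x ∷ xs ⊆ u ++ r → x ∷ xs ⊆ r
⊆-skip-prefix []      _          τ          = τ
⊆-skip-prefix (y ∷ u) (_ ∷ ps)   (.y ∷ʳ τ)  = ⊆-skip-prefix u ps τ
⊆-skip-prefix (y ∷ u) (y≢x ∷ _)  (x≡y ∷ _)  = ⊥-elim (y≢x (sym x≡y))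

low∉big : ∀ {a xs v} → a ≤ 1 → All (1 <_) v → ¬ a ∷ xs ⊆ v
low∉big a≤1 bigV τ = ≤⇒≯ a≤1 (All.head (⊆.All-resp-⊆ τ bigV))

big≢low : ∀ {a u} → a ≤ 1 → All (1 <_) u → All (_≢ a) u
big≢low a≤1 = All.map (λ 1<y y≡a → ≤⇒≯ a≤1 (subst (1 <_) y≡a 1<y))

block-no-low-121 : ∀ {a b} u k v → a ≤ 1 → a < b → All (1 <_) u → All (1 <_) v →
                   ¬ a ∷ b ∷ a ∷ [] ⊆ u ++ replicate k 1 ++ v
block-no-low-121 {a} {b} u k v a≤1 a<b bigU bigV τ = inOnes k (⊆-skip-prefix u (big≢low a≤1 bigU) τ)
  where
  inOnes : ∀ k → ¬ a ∷ b ∷ a ∷ [] ⊆ replicate k 1 ++ v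
  inOnes zero    τ          = low∉big a≤1 bigV τ
  inOnes (suc k) (_ ∷ʳ τ)   = inOnes k τ
  inOnes (suc k) (refl ∷ τ) =
    low∉big a≤1 bigV (⊆.∷ˡ⁻ (⊆-skip-prefix (replicate k 1) (All.replicate⁺ k (<⇒≢ a<b)) τ))

OneBlock : List ℕ → Set
OneBlock w = ∃[ u ] ∃[ j ] ∃[ v ] w ≡ u ++ replicate j 1 ++ v × All (1 <_) u × All (1 <_) v

oneBlock-1∷ : ∀ u j v → All (1 <_) u → All (1 <_) v → ¬ Has121 (1 ∷ u ++ replicate j 1 ++ v) →
               OneBlock (1 ∷ u ++ replicate j 1 ++ v)
oneBlock-1∷ []      j       v _            bigV _     = [] , suc j , v , refl , [] , bigV
oneBlock-1∷ (y ∷ u) zero    v bigU         bigV _     = [] , 1 , y ∷ u ++ v , refl , [] , All.++⁺ bigU bigV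
oneBlock-1∷ (y ∷ u) (suc j) v (1<y ∷ _)    _    no121 =
  ⊥-elim (no121 (1 , y , 1<y , refl ∷ refl ∷ ⊆.++⁺ˡ u (refl ∷ minimum _)))

decompose : ∀ w → All (0 <_) w → ¬ Has121 w → OneBlock w
decompose []      _          _     = [] , 0 , [] , refl , [] , []
decompose (x ∷ w) (0<x ∷ pos) no121
  with decompose w pos (λ (a , b , a<b , τ) → no121 (a , b , a<b , x ∷ʳ τ)) | 1 <? x
... | u , j , v , refl , bigU , bigV | yes 1<x = x ∷ u , j , v , refl , 1<x ∷ bigU , bigV
... | u , j , v , refl , bigU , bigV | no  1≮x with refl ← ≤-antisym (≮⇒≥ 1≮x) 0<x =
  oneBlock-1∷ u j v bigU bigV no121

block-↭⁺ : ∀ u k v {M} → u ++ v ↭ M → u ++ replicate k 1 ++ v ↭ replicate k 1 ++ M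
block-↭⁺ u k v u++v↭M = ↭-trans (↭.shifts u (replicate k 1)) (↭.++⁺ˡ (replicate k 1) u++v↭M)

block-↭⁻ : ∀ {u v M} j k → All (1 <_) u → All (1 <_) v → All (1 <_) M →
           u ++ replicate j 1 ++ v ↭ replicate k 1 ++ M → j ≡ k × u ++ v ↭ M
block-↭⁻ {u} {v} {M} j k bigU bigV bigM w↭ = j≡k , u++v↭M
  where
  u++v↭M : u ++ v ↭ M
  u++v↭M = subst₂ _↭_ (dropOnes-block j bigU bigV) (dropOnes-block {[]} k [] bigM)
                      (↭.filter-↭ (1 <?_) w↭)
  j≡k : j ≡ k
  j≡k = +-cancelʳ-≡ (length M) j k (begin
    j + length M                              ≡⟨ cong (_+_ j) (↭.↭-length u++v↭M) ⟨
    j + length (u ++ v)                       ≡⟨ cong (_+ length (u ++ v)) (length-replicate j) ⟨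
    length (replicate j 1) + length (u ++ v)  ≡⟨ length-++ (replicate j 1) ⟨
    length (replicate j 1 ++ u ++ v)          ≡⟨ ↭.↭-length (↭-trans (↭.shifts (replicate j 1) u) w↭) ⟩
    length (replicate k 1 ++ M)               ≡⟨ length-++ (replicate k 1) ⟩
    length (replicate k 1) + length M         ≡⟨ cong (_+ length M) (length-replicate k) ⟩
    k + length M                              ∎)
    where open ≡-Reasoning

has121-map-suc⁺ : ∀ {w} → Has121 w → Has121 (map suc w)
has121-map-suc⁺ (a , b , a<b , τ) = suc a , suc b , s≤s a<b , ⊆.map⁺ suc τ

has121-map-suc⁻ : ∀ {w} → Has121 (map suc w) → Has121 w
has121-map-suc⁻ {w} (a , b , a<b , τ) with ⊆.All-resp-⊆ τ (map-suc-positive w)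
... | z<s ∷ z<s ∷ _ = pred a , pred b , s≤s⁻¹ a<b , subst (_ ⊆_) (map-pred-suc w) (⊆.map⁺ pred τ)

IsStirling : ∀ {n} → Vec ℕ n → List ℕ → Set
IsStirling s w = w ↭ baseWord s × ¬ Has121 w

stirling-block⁺ : ∀ {m} k (s : Vec ℕ m) {u v w′} →
                  All (1 <_) u → All (1 <_) v → u ++ v ≡ map suc w′ →
                  IsStirling s w′ → IsStirling (k ∷ s) (u ++ replicate k 1 ++ v)
stirling-block⁺ k s {u} {v} {w′} bigU bigV u++v≡ (w′↭ , no121′) = w↭ , no121
  where
  w↭ : u ++ replicate k 1 ++ v ↭ baseWord (k ∷ s)
  w↭ = subst (_ ↭_) (sym (baseWord-∷ k s))
         (block-↭⁺ u k v (subst (_↭ map suc (baseWord s)) (sym u++v≡) (↭.map⁺ suc w′↭)))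
  -- An outer letter ≤ 1 would need a larger letter between two 1s of the block; any other
  -- pattern survives deleting the 1s and lowering the letters.
  no121 : ¬ Has121 (u ++ replicate k 1 ++ v)
  no121 (a , b , a<b , τ) with 1 <? a
  ... | no  1≮a = block-no-low-121 u k v (≮⇒≥ 1≮a) a<b bigU bigV τ
  ... | yes 1<a = no121′ (has121-map-suc⁻ (a , b , a<b , τ′))
    where
    τ′ : a ∷ b ∷ a ∷ [] ⊆ map suc w′
    τ′ = subst₂ _⊆_ (filter-all (1 <?_) (1<a ∷ <-trans 1<a a<b ∷ 1<a ∷ []))
                    (trans (dropOnes-block k bigU bigV) u++v≡)
                    (⊆.filter⁺ (1 <?_) (1 <?_) (λ { refl p → p }) τ)

stirling-block⁻ : ∀ {m} j k (s : Vec ℕ m) {u v w′} →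
                  All (1 <_) u → All (1 <_) v → u ++ v ≡ map suc w′ →
                  IsStirling (k ∷ s) (u ++ replicate j 1 ++ v) → j ≡ k × IsStirling s w′
stirling-block⁻ j k s {u} {v} {w′} bigU bigV u++v≡ (w↭ , no121)
  with j≡k , u++v↭ ← block-↭⁻ j k bigU bigV (map-suc-big (baseWord-positive s))
                                  (subst (_ ↭_) (baseWord-∷ k s) w↭)
  = j≡k , w′↭ , no121′
  where
  w′↭ : w′ ↭ baseWord s
  w′↭ = subst₂ _↭_ (map-pred-suc w′) (map-pred-suc (baseWord s))
                  (↭.map⁺ pred (subst (_↭ _) u++v≡ u++v↭))
  u++v⊆w : map suc w′ ⊆ u ++ replicate j 1 ++ v
  u++v⊆w = subst (_⊆ _) u++v≡ (⊆.++⁺ (⊆-refl {x = u}) (⊆.++⁺ˡ (replicate j 1) ⊆-refl))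
  no121′ : ¬ Has121 w′
  no121′ has121 with a , b , a<b , τ ← has121-map-suc⁺ has121 =
    no121 (a , b , a<b , ⊆-trans τ u++v⊆w)

splice : ℕ → List ℕ → List ℕ → List ℕ
splice p xs w = take p w ++ xs ++ drop p w

splice-length : ∀ u xs v → splice (length u) xs (u ++ v) ≡ u ++ xs ++ v
splice-length []      xs v = refl
splice-length (y ∷ u) xs v = cong (y ∷_) (splice-length u xs v)

-- As for ladderOf, the clause for a code shorter than s is junk.
wordOf : ∀ {n} → Vec ℕ n → List ℕ → List ℕ
wordOf []      _       = []
wordOf (x ∷ s) []      = []
wordOf (x ∷ s) (p ∷ c) = splice p (replicate x 1) (map suc (wordOf s c))

codeOf : ∀ {n} → Vec ℕ n → List ℕ → List ℕ
codeOf []      _ = []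
codeOf (x ∷ s) w = onesStart w ∷ codeOf s (map pred (dropOnes w))

stirling-positive : ∀ {n} (s : Vec ℕ n) {w} → IsStirling s w → All (0 <_) w
stirling-positive s (w↭ , _) = ↭.All-resp-↭ (↭-sym w↭) (baseWord-positive s)

stirling-length : ∀ {n} (s : Vec ℕ n) {w} → IsStirling s w → length w ≡ sum (Vec.toList s)
stirling-length s (w↭ , _) = trans (↭.↭-length w↭) (length-baseWord s)

codeOf-block : ∀ {m} x (s : Vec ℕ m) {u v} → All (1 <_) u → All (1 <_) v →
               codeOf (suc x ∷ s) (u ++ replicate (suc x) 1 ++ v) ≡
               length u ∷ codeOf s (map pred (u ++ v))
codeOf-block x s {u} {v} bigU bigV =
  cong₂ _∷_ (onesStart-block x v bigU) (cong (codeOf s ∘ map pred) (dropOnes-block (suc x) bigU bigV))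

wordOf-isStirling : ∀ {n} {s : Vec ℕ n} {c} → Code s c → IsStirling s (wordOf s c)
wordOf-isStirling []                           = ↭-refl , λ { (_ , _ , _ , ()) }
wordOf-isStirling {s = x ∷ s} {p ∷ c} (_ ∷ code) =
  stirling-block⁺ x s (All.take⁺ p bigM) (All.drop⁺ p bigM) (take++drop≡id p M) st
  where
  st = wordOf-isStirling code
  M = map suc (wordOf s c)
  bigM = map-suc-big (stirling-positive s st)

codeOf-wordOf : ∀ {n} {s : Vec ℕ n} {c} → IsComposition s → Code s c → codeOf s (wordOf s c) ≡ c
codeOf-wordOf _ [] = refl
codeOf-wordOf {s = zero ∷ s} comp (_ ∷ _) with () ← comp Fin.zero
codeOf-wordOf {s = suc x ∷ s} {p ∷ c} comp (p≤Σs ∷ code) = begin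
  codeOf (suc x ∷ s) (take p M ++ replicate (suc x) 1 ++ drop p M)
    ≡⟨ codeOf-block x s (All.take⁺ p bigM) (All.drop⁺ p bigM) ⟩
  length (take p M) ∷ codeOf s (map pred (take p M ++ drop p M))
    ≡⟨ cong₂ (λ i w → i ∷ codeOf s (map pred w)) length-take-p (take++drop≡id p M) ⟩
  p ∷ codeOf s (map pred M)
    ≡⟨ cong (λ w → p ∷ codeOf s w) (map-pred-suc (wordOf s c)) ⟩
  p ∷ codeOf s (wordOf s c)
    ≡⟨ cong (p ∷_) (codeOf-wordOf (comp ∘ Fin.suc) code) ⟩
  p ∷ c
    ∎
  where
  open ≡-Reasoning
  st = wordOf-isStirling code
  M = map suc (wordOf s c)
  bigM = map-suc-big (stirling-positive s st)
  length-take-p : length (take p M) ≡ p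
  length-take-p = trans (length-take p M) (m≤n⇒m⊓n≡m
    (subst (p ≤_) (sym (trans (length-map suc (wordOf s c)) (stirling-length s st))) p≤Σs))

stirling⇒code : ∀ {n} (s : Vec ℕ n) {w} → IsComposition s → IsStirling s w →
                Code s (codeOf s w) × wordOf s (codeOf s w) ≡ w
stirling⇒code []          _    (w↭ , _) rewrite ↭.↭-empty-inv w↭ = [] , refl
stirling⇒code (zero ∷ s)  comp _ with () ← comp Fin.zero
stirling⇒code (suc x ∷ s) {w} comp st@(_ , no121)
  with u , j , v , refl , bigU , bigV ← decompose w (stirling-positive (suc x ∷ s) st) no121
  with refl , st′ ← stirling-block⁻ j (suc x) s bigU bigV (sym (big⇒map-suc-pred (All.++⁺ bigU bigV))) st
  with code′ , word′ ← stirling⇒code s (comp ∘ Fin.suc) st′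
  = subst (λ c → Code (suc x ∷ s) c × wordOf (suc x ∷ s) c ≡ u ++ replicate (suc x) 1 ++ v)
          (sym (codeOf-block x s bigU bigV)) (length-u≤Σs ∷ code′ , word)
  where
  length-u≤Σs : length u ≤ sum (Vec.toList s)
  length-u≤Σs = subst (length u ≤_) (trans (sym (length-map pred (u ++ v))) (stirling-length s st′))
                      (length-++-≤ˡ u)
  word : splice (length u) (replicate (suc x) 1) (map suc (wordOf s (codeOf s (map pred (u ++ v)))))
         ≡ u ++ replicate (suc x) 1 ++ v
  word = trans (cong (splice (length u) (replicate (suc x) 1))
                     (trans (cong (map suc) word′) (big⇒map-suc-pred (All.++⁺ bigU bigV))))
               (splice-length u (replicate (suc x) 1) v)

stirlings≈codes : ∀ {n} (s : Vec ℕ n) → IsComposition s → Correspondence (IsStirlingPerm s) (Code s)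
stirlings≈codes s comp = record
  { to        = codeOf s
  ; from      = wordOf s
  ; to-resp   = λ st → proj₁ (stirling⇒code s comp (toIsStirling st))
  ; from-resp = λ code → let w↭ , no121 = wordOf-isStirling code in w↭ , ¬has121⇒avoids121 no121
  ; from∘to   = λ st → proj₂ (stirling⇒code s comp (toIsStirling st))
  ; to∘from   = codeOf-wordOf comp
  }
  where
  toIsStirling : ∀ {w} → IsStirlingPerm s w → IsStirling s w
  toIsStirling (w↭ , avoids) = w↭ , avoids121⇒¬has121 avoids

theorem6p4 : (n : ℕ) (s : Vec ℕ n) → IsComposition s →
    Bij (IsStirlingPerm s) (IsIntFlow (Data.Nat.suc n) (oruga s) (netflowD s))
theorem6p4 n s comp = Correspondence⇒Bij (Correspondence-trans (stirlings≈codes s comp) (codes≈flows s))
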